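{- Let $t$ be the Thue–Morse word and let $w$ be a nonempty privileged factor of $t$ of even length. Then $00$ or $11$ is a factor of $w$.
   Context: The Thue–Morse word $t$ is the fixed point starting with $0$ of the morphism $0\mapsto 01$, $1\mapsto 10$, i.e. $t=\lim_{n\to\infty}\varphi^n(0)$. A complete first return to $u$ is a word that starts with $u$, ends with $u$, and contains exactly two occurrences of $u$. Privileged words are defined recursively: the empty word is privileged; every letter is privileged; a word of length at least $2$ is privileged if it is a complete first return to a shorter privileged word. -}

module Defs where

open import Data.Bool using (Bool; true; false; not)
open import Data.Nat using (ℕ; zero; suc; _+_; _<_; _≤_)
open import Data.Nat.DivMod using (_/_)
open import Data.List using (List; []; _∷_; length; drop; _++_)
open import Data.Product using (∃; _×_; _,_)
open import Relation.Binary.PropositionalEquality using (_≡_)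

-- Words over the binary alphabet {0,1}; the letter 0 is false, 1 is true.
Word : Set
Word = List Bool

-- Thue–Morse word t = lim φⁿ(0), φ(0)=01, φ(1)=10.
-- Standard description of its letters: t(0)=0, t(2n)=t(n), t(2n+1)=¬t(n).
odd? : ℕ → Bool
odd? zero = false
odd? (suc zero) = true
odd? (suc (suc k)) = odd? k

-- fuel-bounded recursion; fuel n+1 suffices for argument n
tmAux : ℕ → ℕ → Bool
tmAux zero n = false
tmAux (suc fuel) zero = false
tmAux (suc fuel) (suc n) with odd? (suc n)
... | false = tmAux fuel (suc n / 2)
... | true  = not (tmAux fuel (suc n / 2))

tm : ℕ → Bool
tm n = tmAux (suc n) n

tmFactor : ℕ → ℕ → Word
tmFactor i zero = []
tmFactor i (suc m) = tm i ∷ tmFactor (suc i) m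

IsFactorOfTM : Word → Set
IsFactorOfTM w = ∃ λ i → w ≡ tmFactor i (length w)

IsFactor : Word → Word → Set
IsFactor u w = ∃ λ x → ∃ λ y → w ≡ x ++ u ++ y

IsPrefix : Word → Word → Set
IsPrefix u w = ∃ λ y → w ≡ u ++ y

IsSuffix : Word → Word → Set
IsSuffix u w = ∃ λ x → w ≡ x ++ u

OccursAt : Word → Word → ℕ → Set
OccursAt u w i = i + length u ≤ length w × IsPrefix u (drop i w)

ExactlyTwoOccurrences : Word → Word → Set
ExactlyTwoOccurrences u w =
  ∃ λ i → ∃ λ j → i < j × OccursAt u w i × OccursAt u w j ×
    (∀ k → OccursAt u w k → k ≡ i ⊎' k ≡ j)
  where
  open import Data.Sum using () renaming (_⊎_ to _⊎'_)

CompleteFirstReturn : Word → Word → Set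
CompleteFirstReturn u w = IsPrefix u w × IsSuffix u w × ExactlyTwoOccurrences u w

data Privileged : Word → Set where
  priv-empty  : Privileged []
  priv-letter : (a : Bool) → Privileged (a ∷ [])
  priv-return : (u w : Word) → 2 ≤ length w → length u < length w →
                Privileged u → CompleteFirstReturn u w → Privileged w

module Submission where

-- A privileged word of even positive length contains 00 or 11.
--
-- Every binary word either contains a repeated letter (00 or 11) or is
-- alternating, i.e. of the form a (¬a) a (¬a) …  So it suffices to show that
-- no alternating word of even positive length is privileged.  A complete first return to the
-- empty word has length at most 1, since [] occurs at every position.  If w
-- is a complete first return to a nonempty u, then u is both a prefix and a
-- suffix of w; prefixes and suffixes of alternating words are alternating,
-- and comparing first letters shows that the suffix starts at an even
-- position, so u is again alternating of even positive length, and the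
-- induction hypothesis applies.  Parity is expressed by iterating negation:
-- n is even exactly when (not ∘ … ∘ not) applied n times to a gives back a.

open import Defs
open import Data.Bool using (Bool; true; false; not)
open import Data.Bool.Properties using (not-involutive)
open import Data.Nat using (ℕ; zero; suc; _*_; _<_; _+_; _≤_; z≤n; s≤s)
open import Data.Nat.GeneralisedArithmetic using (iterate)
open import Data.Nat.Properties using (*-suc; +-identityʳ; n≤1+n; ≤-trans)
open import Data.List using ([]; _∷_; length; _++_; drop)
open import Data.List.Properties using (∷-injectiveˡ; ∷-injectiveʳ)
open import Data.Product using (∃; _×_; _,_)
open import Data.Sum using (_⊎_; inj₁; inj₂)
open import Data.Empty using (⊥; ⊥-elim)
open import Relation.Nullary using (¬_)
open import Relation.Binary.PropositionalEquality
open ≡-Reasoning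

iterate-+ : ∀ {A : Set} (f : A → A) (a : A) m n →
  iterate f a (m + n) ≡ iterate f (iterate f a m) n
iterate-+ f a zero    n = refl
iterate-+ f a (suc m) n = iterate-+ f (f a) m n

iterate-not-even : ∀ a k → iterate not a (2 * k) ≡ a
iterate-not-even a zero    = refl
iterate-not-even a (suc k) = begin
  iterate not a (2 * suc k)          ≡⟨ cong (iterate not a) (*-suc 2 k) ⟩
  iterate not (not (not a)) (2 * k)  ≡⟨ cong (λ b → iterate not b (2 * k)) (not-involutive a) ⟩
  iterate not a (2 * k)              ≡⟨ iterate-not-even a k ⟩
  a                                  ∎

not-no-fixpoint : ∀ a → not a ≢ a
not-no-fixpoint false ()
not-no-fixpoint true  ()

alternating : Bool → ℕ → Word
alternating a zero    = []
alternating a (suc n) = a ∷ alternating (not a) n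

length-alternating : ∀ a n → length (alternating a n) ≡ n
length-alternating a zero    = refl
length-alternating a (suc n) = cong suc (length-alternating (not a) n)

prefix-alternating : ∀ a n u y → alternating a n ≡ u ++ y →
  u ≡ alternating a (length u)
prefix-alternating a n       []      y eq = refl
prefix-alternating a zero    (b ∷ u) y ()
prefix-alternating a (suc n) (b ∷ u) y eq =
  cong₂ _∷_ (sym (∷-injectiveˡ eq)) (prefix-alternating (not a) n u y (∷-injectiveʳ eq))

suffix-alternating : ∀ a n x u → alternating a n ≡ x ++ u →
  u ≡ alternating (iterate not a (length x)) (length u) × length x + length u ≡ n
suffix-alternating a n [] u eq =
  subst (λ v → v ≡ alternating a (length v)) eq
        (cong (alternating a) (sym (length-alternating a n)))
  , trans (cong length (sym eq)) (length-alternating a n)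
suffix-alternating a zero    (b ∷ x) u ()
suffix-alternating a (suc n) (b ∷ x) u eq
  with suffix-alternating (not a) n x u (∷-injectiveʳ eq)
... | u-alternating , lengths = u-alternating , cong suc lengths

alternating-tail : ∀ {b c r n} → b ∷ r ≡ alternating c (suc n) →
  r ≡ alternating (not b) n
alternating-tail eq with ∷-injectiveˡ eq
... | refl = ∷-injectiveʳ eq

HasRepeatedLetter : Word → Set
HasRepeatedLetter w =
  IsFactor (false ∷ false ∷ []) w ⊎ IsFactor (true ∷ true ∷ []) w

repeated-or-alternating : (w : Word) →
  HasRepeatedLetter w ⊎ ∃ (λ a → w ≡ alternating a (length w))
repeated-or-alternating []      = inj₂ (false , refl)
repeated-or-alternating (a ∷ []) = inj₂ (a , refl)
repeated-or-alternating (a ∷ b ∷ r) with repeated-or-alternating (b ∷ r)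
... | inj₁ (inj₁ (x , y , eq)) = inj₁ (inj₁ (a ∷ x , y , cong (a ∷_) eq))
... | inj₁ (inj₂ (x , y , eq)) = inj₁ (inj₂ (a ∷ x , y , cong (a ∷_) eq))
repeated-or-alternating (false ∷ false ∷ r) | inj₂ _ = inj₁ (inj₁ ([] , r , refl))
repeated-or-alternating (true  ∷ true  ∷ r) | inj₂ _ = inj₁ (inj₂ ([] , r , refl))
repeated-or-alternating (false ∷ true ∷ r) | inj₂ (_ , eq) =
  inj₂ (false , cong (λ v → false ∷ true ∷ v) (alternating-tail eq))
repeated-or-alternating (true ∷ false ∷ r) | inj₂ (_ , eq) =
  inj₂ (true , cong (λ v → true ∷ false ∷ v) (alternating-tail eq))

empty-occurs : ∀ w k → k ≤ length w → OccursAt [] w k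
empty-occurs w k k≤|w| =
  subst (_≤ length w) (sym (+-identityʳ k)) k≤|w| , drop k w , refl

three-not-in-pair : ∀ {i j} → i < j →
  (0 ≡ i ⊎ 0 ≡ j) → (1 ≡ i ⊎ 1 ≡ j) → (2 ≡ i ⊎ 2 ≡ j) → ⊥
three-not-in-pair i<j (inj₁ refl) (inj₁ ())   _
three-not-in-pair i<j (inj₁ refl) (inj₂ refl) (inj₁ ())
three-not-in-pair i<j (inj₁ refl) (inj₂ refl) (inj₂ ())
three-not-in-pair ()  (inj₂ refl) _           _

empty-not-twice : ∀ w → 2 ≤ length w → ¬ ExactlyTwoOccurrences [] w
empty-not-twice w 2≤|w| (i , j , i<j , _ , _ , onlyIJ) =
  three-not-in-pair i<j
    (onlyIJ 0 (empty-occurs w 0 z≤n))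
    (onlyIJ 1 (empty-occurs w 1 (≤-trans (n≤1+n 1) 2≤|w|)))
    (onlyIJ 2 (empty-occurs w 2 2≤|w|))

-- here the hypothesis  iterate not a n ≡ a  says that n is even
even-alternating-not-privileged : ∀ {w} → Privileged w → ∀ a n →
  w ≡ alternating a n → 0 < n → iterate not a n ≡ a → ⊥
even-alternating-not-privileged priv-empty a (suc n) () _ _
even-alternating-not-privileged (priv-letter b) a (suc zero) _ _ n-even =
  not-no-fixpoint a n-even
even-alternating-not-privileged (priv-letter b) a (suc (suc n)) () _ _
even-alternating-not-privileged (priv-return [] w 2≤|w| _ _ (_ , _ , twice)) _ _ _ _ _ =
  empty-not-twice w 2≤|w| twice
even-alternating-not-privileged
  (priv-return (b ∷ u′) w _ _ u-privileged ((y , w≡uy) , (x , w≡xu) , _))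
  a n w-alternating _ n-even
  with prefix-alternating a n (b ∷ u′) y (trans (sym w-alternating) w≡uy)
     | suffix-alternating a n x (b ∷ u′) (trans (sym w-alternating) w≡xu)
... | u-prefix | u-suffix , lengths =
  even-alternating-not-privileged u-privileged a (length u) u-prefix (s≤s z≤n) u-even
  where
  u : Word
  u = b ∷ u′

  -- u starts both at position 0 and at position |x|, so |x| is even
  x-even : a ≡ iterate not a (length x)
  x-even = ∷-injectiveˡ (trans (sym u-prefix) u-suffix)

  u-even : iterate not a (length u) ≡ a
  u-even = begin
    iterate not a (length u)                         ≡⟨ cong (λ c → iterate not c (length u)) x-even ⟩
    iterate not (iterate not a (length x)) (length u) ≡⟨ sym (iterate-+ not a (length x) (length u)) ⟩
    iterate not a (length x + length u)              ≡⟨ cong (iterate not a) lengths ⟩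
    iterate not a n                                  ≡⟨ n-even ⟩
    a                                                ∎

mainTheorem18 : (w : Word) → IsFactorOfTM w → Privileged w →
    0 < length w → (∃ λ k → length w ≡ 2 * k) →
    IsFactor (false ∷ false ∷ []) w ⊎ IsFactor (true ∷ true ∷ []) w
mainTheorem18 w _ w-privileged |w|>0 (k , |w|≡2k) with repeated-or-alternating w
... | inj₁ repeated = repeated
... | inj₂ (a , w-alternating) =
  ⊥-elim (even-alternating-not-privileged w-privileged a (length w) w-alternating |w|>0
           (trans (cong (iterate not a) |w|≡2k) (iterate-not-even a k)))
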